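{- Let $X$ be a finite set with $|X|=n$ and let $S\subseteq X^3$ be an orthogonal array of degree $3$ and strength $2$ on $X$. For any $2$-coloring of $X$ with color classes $X_1,X_2$, the number $|M|$ of monochromatic vectors of $S$ satisfies $$|M|=|X_1|^2-|X_1|\cdot|X_2|+|X_2|^2.$$ In particular, for any $2$-coloring of $X$ there are at least $n^2/4$ monochromatic vectors in $S$.
   Context: $S\subseteq X^3$ is an orthogonal array of degree 3 and strength 2 on $X$ if for any two distinct coordinate positions $i<j$ in $\{1,2,3\}$ and any $a,b\in X$ there is exactly one $(y_1,y_2,y_3)\in S$ with $y_i=a$, $y_j=b$. A vector is monochromatic if all its coordinates lie in the same color class. -}

module Defs where

open import Data.Nat using (ℕ; zero; suc; _+_)
open import Data.Fin using (Fin; zero; suc)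
open import Data.Bool using (Bool; true; false; if_then_else_; _∧_)
open import Data.Product using (Σ; _×_)
open import Relation.Binary.PropositionalEquality using (_≡_)

sumFin : (n : ℕ) → (Fin n → ℕ) → ℕ
sumFin zero    f = 0
sumFin (suc n) f = f zero + sumFin n (λ i → f (suc i))

countFin : (n : ℕ) → (Fin n → Bool) → ℕ
countFin n p = sumFin n (λ i → if p i then 1 else 0)

∃!Fin : (n : ℕ) → (Fin n → Set) → Set
∃!Fin n P = Σ (Fin n) (λ c → P c × ((c' : Fin n) → P c' → c' ≡ c))

-- A subset S ⊆ X³ (X = Fin n) is given by its characteristic function.
Triples : ℕ → Set
Triples n = Fin n → Fin n → Fin n → Bool

IsOA : (n : ℕ) → Triples n → Set
IsOA n S =
  ((a b : Fin n) → ∃!Fin n (λ c → S a b c ≡ true)) ×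
  ((a b : Fin n) → ∃!Fin n (λ c → S a c b ≡ true)) ×
  ((a b : Fin n) → ∃!Fin n (λ c → S c a b ≡ true))

sameColour : Bool → Bool → Bool
sameColour true  true  = true
sameColour false false = true
sameColour _     _     = false

-- A 2-colouring χ : X → Bool; colour class X₁ = χ⁻¹(true), X₂ = χ⁻¹(false).
-- Monochromatic: all coordinates in the same colour class.
monochromatic : {n : ℕ} → (Fin n → Bool) → Fin n → Fin n → Fin n → Bool
monochromatic χ a b c = sameColour (χ a) (χ b) ∧ sameColour (χ b) (χ c)

numMono : (n : ℕ) → Triples n → (Fin n → Bool) → ℕ
numMono n S χ =
  sumFin n (λ a → sumFin n (λ b → countFin n (λ c → S a b c ∧ monochromatic χ a b c)))

class₁ : (n : ℕ) → (Fin n → Bool) → ℕ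
class₁ n χ = countFin n χ

class₂ : (n : ℕ) → (Fin n → Bool) → ℕ
class₂ n χ = countFin n (λ x → if χ x then false else true)

-- We count, in two ways, the pairs (v, {i, j}) with v ∈ S and {i, j} a pair of
-- coordinate positions on which v has equal colours.
--   * Per vector: a monochromatic vector has 3 such pairs and every other
--     vector exactly 1, so the count is 2M + |S| = 2M + n².
--   * Per pair of positions: by strength 2 the vectors of S restricted to
--     {i, j} run through X² exactly once, so each of the 3 position pairs
--     contributes the number x² + y² of equally coloured pairs in X².
-- Hence 2M + (x + y)² = 3(x² + y²), i.e. M + xy = x² + y², and since
-- 4(x² + y²) - (x + y)² - 4xy = 3(x - y)² ≥ 0 this gives n² ≤ 4M.
module Submission where

open import Defs
open import Data.Nat using (ℕ; zero; suc; _+_; _*_; _^_; _≤_; _∸_)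
open import Data.Nat.Properties
  using ( +-*-semiring; *-identityˡ; *-identityʳ; *-comm; +-comm; *-cancelˡ-≡
        ; +-cancelʳ-≡; +-cancelʳ-≤; *-distribˡ-+; ≤-total; m≤m+n; m+[n∸m]≡n)
open import Data.Nat.Tactic.RingSolver using (solve-∀)
open import Data.Fin using (Fin; zero; suc)
open import Data.Fin.Properties using (0≢1+n; suc-injective)
open import Data.Bool using (Bool; true; false; if_then_else_; _∧_)
open import Data.Bool.Properties using (¬-not)
open import Data.Product using (_×_; _,_; proj₁; proj₂)
open import Data.Sum using (inj₁; inj₂)
open import Function using (_∘_)
open import Relation.Binary.PropositionalEquality
  using (_≡_; refl; sym; trans; cong; cong₂; subst; subst₂; module ≡-Reasoning)
open import Algebra.Properties.Semiring.Sum +-*-semiring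
  using (sum; sum-syntax; sum-cong-≗; sum-replicate-zero; ∑-distrib-+; ∑-comm
        ; *-distribˡ-sum; *-distribʳ-sum)

⟦_⟧ : Bool → ℕ
⟦ b ⟧ = if b then 1 else 0

opposite : Bool → Bool
opposite b = if b then false else true

sumFin≡sum : ∀ n (f : Fin n → ℕ) → sumFin n f ≡ sum f
sumFin≡sum zero    f = refl
sumFin≡sum (suc n) f = cong (f zero +_) (sumFin≡sum n (f ∘ suc))

∑-one : ∀ n → ∑[ i < n ] 1 ≡ n
∑-one zero    = refl
∑-one (suc n) = cong suc (∑-one n)

∑² : ∀ {n} → (Fin n → Fin n → ℕ) → ℕ
∑² {n} w = ∑[ a < n ] ∑[ b < n ] w a b

∑³ : ∀ {n} → (Fin n → Fin n → Fin n → ℕ) → ℕ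
∑³ {n} F = ∑[ a < n ] ∑[ b < n ] ∑[ c < n ] F a b c

∑²-product : ∀ {n} (f g : Fin n → ℕ) → ∑² (λ a b → f a * g b) ≡ sum f * sum g
∑²-product {n} f g = begin
  ∑[ a < n ] ∑[ b < n ] (f a * g b) ≡⟨ sum-cong-≗ (λ a → sym (*-distribˡ-sum (f a) g)) ⟩
  ∑[ a < n ] (f a * sum g)         ≡⟨ sym (*-distribʳ-sum (sum g) f) ⟩
  sum f * sum g                    ∎
  where open ≡-Reasoning

∑³-cong : ∀ {n} {F G : Fin n → Fin n → Fin n → ℕ} →
          (∀ a b c → F a b c ≡ G a b c) → ∑³ F ≡ ∑³ G
∑³-cong F≡G = sum-cong-≗ (λ a → sum-cong-≗ (λ b → sum-cong-≗ (F≡G a b)))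

∑³-+ : ∀ {n} (F G : Fin n → Fin n → Fin n → ℕ) →
       ∑³ (λ a b c → F a b c + G a b c) ≡ ∑³ F + ∑³ G
∑³-+ F G =
  trans (sum-cong-≗ (λ a → trans (sum-cong-≗ (λ b → ∑-distrib-+ (F a b) (G a b)))
                                 (∑-distrib-+ (sum ∘ F a) (sum ∘ G a))))
        (∑-distrib-+ (∑² ∘ F) (∑² ∘ G))

∑³-*ˡ : ∀ {n} k (F : Fin n → Fin n → Fin n → ℕ) → ∑³ (λ a b c → k * F a b c) ≡ k * ∑³ F
∑³-*ˡ k F =
  sym (trans (*-distribˡ-sum k (∑² ∘ F))
             (sum-cong-≗ (λ a → trans (*-distribˡ-sum k (sum ∘ F a))
                                      (sum-cong-≗ (λ b → *-distribˡ-sum k (F a b))))))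

∑³-swap₂₃ : ∀ {n} (F : Fin n → Fin n → Fin n → ℕ) → ∑³ F ≡ ∑³ (λ a c b → F a b c)
∑³-swap₂₃ F = sum-cong-≗ (λ a → ∑-comm (F a))

∑³-rotate : ∀ {n} (F : Fin n → Fin n → Fin n → ℕ) → ∑³ F ≡ ∑³ (λ b c a → F a b c)
∑³-rotate F = trans (∑-comm (λ a b → sum (F a b)))
                    (sum-cong-≗ (λ b → ∑-comm (λ a c → F a b c)))

count-none : ∀ {n} (p : Fin n → Bool) → (∀ i → p i ≡ false) → ∑[ i < n ] ⟦ p i ⟧ ≡ 0
count-none {n} p none = trans (sum-cong-≗ (λ i → cong ⟦_⟧ (none i))) (sum-replicate-zero n)

count-unique : ∀ {n} (p : Fin n → Bool) → ∃!Fin n (λ c → p c ≡ true) → ∑[ i < n ] ⟦ p i ⟧ ≡ 1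
count-unique {zero}  p (() , _)
count-unique {suc n} p (zero , p₀ , unique) rewrite p₀ =
  cong suc (count-none (p ∘ suc) (λ i → ¬-not (0≢1+n ∘ sym ∘ unique (suc i))))
count-unique {suc n} p (suc c , pc , unique) rewrite ¬-not {p zero} (0≢1+n ∘ unique zero) =
  count-unique (p ∘ suc) (c , pc , λ c′ pc′ → suc-injective (unique (suc c′) pc′))

∑-over-fibres : ∀ {n} (P : Fin n → Fin n → Fin n → Bool) →
                (∀ a b → ∃!Fin n (λ c → P a b c ≡ true)) → (w : Fin n → Fin n → ℕ) →
                ∑³ (λ a b c → ⟦ P a b c ⟧ * w a b) ≡ ∑² w
∑-over-fibres P fibre w = sum-cong-≗ (λ a → sum-cong-≗ (λ b → begin
  ∑[ c < _ ] (⟦ P a b c ⟧ * w a b) ≡⟨ sym (*-distribʳ-sum (w a b) (⟦_⟧ ∘ P a b)) ⟩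
  sum (⟦_⟧ ∘ P a b) * w a b       ≡⟨ cong (_* w a b) (count-unique (P a b) (fibre a b)) ⟩
  1 * w a b                       ≡⟨ *-identityˡ (w a b) ⟩
  w a b                           ∎))
  where open ≡-Reasoning

-- In an orthogonal array of strength 2, for each pair of positions the
-- vectors of S restricted to those positions run through X² exactly once, so
-- a weight on that pair of positions sums over S to its sum over X².
module PairSums {n : ℕ} {S : Triples n} (oa : IsOA n S) where

  ∑-over-S₁₂ : (w : Fin n → Fin n → ℕ) → ∑³ (λ a b c → ⟦ S a b c ⟧ * w a b) ≡ ∑² w
  ∑-over-S₁₂ = ∑-over-fibres S (proj₁ oa)

  ∑-over-S₁₃ : (w : Fin n → Fin n → ℕ) → ∑³ (λ a b c → ⟦ S a b c ⟧ * w a c) ≡ ∑² w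
  ∑-over-S₁₃ w = trans (∑³-swap₂₃ (λ a b c → ⟦ S a b c ⟧ * w a c))
                       (∑-over-fibres (λ a c b → S a b c) (proj₁ (proj₂ oa)) w)

  ∑-over-S₂₃ : (w : Fin n → Fin n → ℕ) → ∑³ (λ a b c → ⟦ S a b c ⟧ * w b c) ≡ ∑² w
  ∑-over-S₂₃ w = trans (∑³-rotate (λ a b c → ⟦ S a b c ⟧ * w b c))
                       (∑-over-fibres (λ b c a → S a b c) (proj₂ (proj₂ oa)) w)

  size : ∑³ (λ a b c → ⟦ S a b c ⟧) ≡ n * n
  size = begin
    ∑³ (λ a b c → ⟦ S a b c ⟧)          ≡⟨ ∑³-cong (λ a b c → sym (*-identityʳ ⟦ S a b c ⟧)) ⟩
    ∑³ (λ a b c → ⟦ S a b c ⟧ * 1)      ≡⟨ ∑-over-S₁₂ (λ _ _ → 1 * 1) ⟩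
    ∑² {n} (λ _ _ → 1 * 1)              ≡⟨ ∑²-product {n} (λ _ → 1) (λ _ → 1) ⟩
    (∑[ i < n ] 1) * (∑[ i < n ] 1)     ≡⟨ cong₂ _*_ (∑-one n) (∑-one n) ⟩
    n * n                               ∎
    where open ≡-Reasoning

same-split : ∀ p q → ⟦ sameColour p q ⟧ ≡ ⟦ p ⟧ * ⟦ q ⟧ + ⟦ opposite p ⟧ * ⟦ opposite q ⟧
same-split true  true  = refl
same-split true  false = refl
same-split false true  = refl
same-split false false = refl

-- Among the three pairs of positions of a 2-coloured triple, all three agree
-- if it is monochromatic and exactly one agrees otherwise.
agreeing-pairs : ∀ p q r →
  2 * ⟦ sameColour p q ∧ sameColour q r ⟧ + 1
    ≡ ⟦ sameColour p q ⟧ + ⟦ sameColour p r ⟧ + ⟦ sameColour q r ⟧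
agreeing-pairs true  true  true  = refl
agreeing-pairs true  true  false = refl
agreeing-pairs true  false true  = refl
agreeing-pairs true  false false = refl
agreeing-pairs false true  true  = refl
agreeing-pairs false true  false = refl
agreeing-pairs false false true  = refl
agreeing-pairs false false false = refl

agreeing-pairs-in : ∀ s p q r →
  2 * ⟦ s ∧ (sameColour p q ∧ sameColour q r) ⟧ + ⟦ s ⟧
    ≡ ⟦ s ⟧ * ⟦ sameColour p q ⟧ + ⟦ s ⟧ * ⟦ sameColour p r ⟧ + ⟦ s ⟧ * ⟦ sameColour q r ⟧
agreeing-pairs-in false p q r = refl
agreeing-pairs-in true  p q r =
  trans (agreeing-pairs p q r)
        (sym (cong₂ _+_ (cong₂ _+_ (*-identityˡ ⟦ sameColour p q ⟧)
                                   (*-identityˡ ⟦ sameColour p r ⟧))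
                        (*-identityˡ ⟦ sameColour q r ⟧)))

module Colouring {n : ℕ} (χ : Fin n → Bool) where

  x y : ℕ
  x = ∑[ i < n ] ⟦ χ i ⟧
  y = ∑[ i < n ] ⟦ opposite (χ i) ⟧

  partition : x + y ≡ n
  partition = begin
    x + y                                      ≡⟨ sym (∑-distrib-+ (⟦_⟧ ∘ χ) (⟦_⟧ ∘ opposite ∘ χ)) ⟩
    ∑[ i < n ] (⟦ χ i ⟧ + ⟦ opposite (χ i) ⟧)  ≡⟨ sum-cong-≗ (λ i → one-colour (χ i)) ⟩
    ∑[ i < n ] 1                               ≡⟨ ∑-one n ⟩
    n                                          ∎
    where
    open ≡-Reasoning
    one-colour : ∀ p → ⟦ p ⟧ + ⟦ opposite p ⟧ ≡ 1
    one-colour true  = refl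
    one-colour false = refl

  agree : Fin n → Fin n → ℕ
  agree a b = ⟦ sameColour (χ a) (χ b) ⟧

  ∑-agree : ∑² agree ≡ x * x + y * y
  ∑-agree = begin
    ∑² agree
      ≡⟨ sum-cong-≗ (λ a → sum-cong-≗ (λ b → same-split (χ a) (χ b))) ⟩
    ∑² (λ a b → u a * u b + v a * v b)
      ≡⟨ sum-cong-≗ (λ a → ∑-distrib-+ (λ b → u a * u b) (λ b → v a * v b)) ⟩
    ∑[ a < n ] (∑[ b < n ] (u a * u b) + ∑[ b < n ] (v a * v b))
      ≡⟨ ∑-distrib-+ (λ a → ∑[ b < n ] (u a * u b)) (λ a → ∑[ b < n ] (v a * v b)) ⟩
    ∑² (λ a b → u a * u b) + ∑² (λ a b → v a * v b)
      ≡⟨ cong₂ _+_ (∑²-product u u) (∑²-product v v) ⟩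
    x * x + y * y
      ∎
    where
    open ≡-Reasoning
    u v : Fin n → ℕ
    u = ⟦_⟧ ∘ χ
    v = ⟦_⟧ ∘ opposite ∘ χ

thrice : ∀ m → m + m + m ≡ 3 * m
thrice = solve-∀

expand : ∀ k a b → 2 * (k + a * b) + (a * a + b * b) ≡ 2 * k + (a + b) * (a + b)
expand = solve-∀

regroup : ∀ q → 3 * q ≡ 2 * q + q
regroup = solve-∀

mono-formula : ∀ m x y → 2 * m + (x + y) * (x + y) ≡ 3 * (x * x + y * y) →
               m + x * y ≡ x * x + y * y
mono-formula m x y count = *-cancelˡ-≡ (m + x * y) (x * x + y * y) 2
  (+-cancelʳ-≡ (x * x + y * y) (2 * (m + x * y)) (2 * (x * x + y * y)) (begin
    2 * (m + x * y) + (x * x + y * y)      ≡⟨ expand m x y ⟩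
    2 * m + (x + y) * (x + y)              ≡⟨ count ⟩
    3 * (x * x + y * y)                    ≡⟨ regroup (x * x + y * y) ⟩
    2 * (x * x + y * y) + (x * x + y * y)  ∎))
  where open ≡-Reasoning

gap : ∀ a d → (a + (a + d)) * (a + (a + d)) + 4 * (a * (a + d)) + 3 * (d * d)
              ≡ 4 * (a * a + (a + d) * (a + d))
gap = solve-∀

-- 4(x² + y²) exceeds (x + y)² + 4xy by 3(x − y)² ≥ 0; first for x ≤ y,
-- writing y = x + d.
four-squares-ordered : ∀ {x y} → x ≤ y →
                       (x + y) * (x + y) + 4 * (x * y) ≤ 4 * (x * x + y * y)
four-squares-ordered {x} {y} x≤y =
  subst (λ z → (x + z) * (x + z) + 4 * (x * z) ≤ 4 * (x * x + z * z)) (m+[n∸m]≡n x≤y)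
    (subst (lhs ≤_) (gap x d) (m≤m+n lhs (3 * (d * d))))
  where
  d = y ∸ x
  lhs = (x + (x + d)) * (x + (x + d)) + 4 * (x * (x + d))

-- Both sides are symmetric in x and y, so the ordered case suffices.
four-squares : ∀ x y → (x + y) * (x + y) + 4 * (x * y) ≤ 4 * (x * x + y * y)
four-squares x y with ≤-total x y
... | inj₁ x≤y = four-squares-ordered x≤y
... | inj₂ y≤x = subst₂ _≤_
  (cong₂ _+_ (cong₂ _*_ (+-comm y x) (+-comm y x)) (cong (4 *_) (*-comm y x)))
  (cong (4 *_) (+-comm (y * y) (x * x)))
  (four-squares-ordered y≤x)

square-bound : ∀ m x y → m + x * y ≡ x * x + y * y → (x + y) * (x + y) ≤ 4 * m
square-bound m x y formula = +-cancelʳ-≤ (4 * (x * y)) ((x + y) * (x + y)) (4 * m)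
  (subst ((x + y) * (x + y) + 4 * (x * y) ≤_)
         (trans (cong (4 *_) (sym formula)) (*-distribˡ-+ 4 m (x * y)))
         (four-squares x y))

module DoubleCount {n : ℕ} {S : Triples n} (oa : IsOA n S) (χ : Fin n → Bool) where
  open PairSums oa
  open Colouring χ

  mono : ℕ
  mono = ∑³ (λ a b c → ⟦ S a b c ∧ monochromatic χ a b c ⟧)

  double-count : 2 * mono + n * n ≡ 3 * (x * x + y * y)
  double-count = begin
    2 * mono + n * n
      ≡⟨ cong₂ _+_ (sym (∑³-*ˡ 2 M)) (sym size) ⟩
    ∑³ (λ a b c → 2 * M a b c) + ∑³ T
      ≡⟨ sym (∑³-+ (λ a b c → 2 * M a b c) T) ⟩
    ∑³ (λ a b c → 2 * M a b c + T a b c)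
      ≡⟨ ∑³-cong (λ a b c → agreeing-pairs-in (S a b c) (χ a) (χ b) (χ c)) ⟩
    ∑³ (λ a b c → A₁₂ a b c + A₁₃ a b c + A₂₃ a b c)
      ≡⟨ trans (∑³-+ (λ a b c → A₁₂ a b c + A₁₃ a b c) A₂₃)
               (cong (_+ ∑³ A₂₃) (∑³-+ A₁₂ A₁₃)) ⟩
    ∑³ A₁₂ + ∑³ A₁₃ + ∑³ A₂₃
      ≡⟨ cong₂ _+_ (cong₂ _+_ (∑-over-S₁₂ agree) (∑-over-S₁₃ agree)) (∑-over-S₂₃ agree) ⟩
    ∑² agree + ∑² agree + ∑² agree
      ≡⟨ cong (λ t → t + t + t) ∑-agree ⟩
    (x * x + y * y) + (x * x + y * y) + (x * x + y * y)
      ≡⟨ thrice (x * x + y * y) ⟩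
    3 * (x * x + y * y)
      ∎
    where
    open ≡-Reasoning
    T M A₁₂ A₁₃ A₂₃ : Fin n → Fin n → Fin n → ℕ
    T   a b c = ⟦ S a b c ⟧
    M   a b c = ⟦ S a b c ∧ monochromatic χ a b c ⟧
    A₁₂ a b c = T a b c * agree a b
    A₁₃ a b c = T a b c * agree a c
    A₂₃ a b c = T a b c * agree b c

  mono-identity : mono + x * y ≡ x * x + y * y
  mono-identity = mono-formula mono x y
    (subst (λ m → 2 * mono + m * m ≡ 3 * (x * x + y * y)) (sym partition) double-count)

  mono-bound : n * n ≤ 4 * mono
  mono-bound = subst (λ m → m * m ≤ 4 * mono) partition (square-bound mono x y mono-identity)

numMono≡∑³ : ∀ n (S : Triples n) χ →
             numMono n S χ ≡ ∑³ (λ a b c → ⟦ S a b c ∧ monochromatic χ a b c ⟧)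
numMono≡∑³ n S χ =
  trans (sumFin≡sum n (λ a → sumFin n (λ b → countFin n (mono a b))))
        (sum-cong-≗ (λ a → trans (sumFin≡sum n (λ b → countFin n (mono a b)))
                                 (sum-cong-≗ (λ b → sumFin≡sum n (⟦_⟧ ∘ mono a b)))))
  where
  mono : Fin n → Fin n → Fin n → Bool
  mono a b c = S a b c ∧ monochromatic χ a b c

class₁≡x : ∀ n (χ : Fin n → Bool) → class₁ n χ ≡ Colouring.x χ
class₁≡x n χ = sumFin≡sum n (⟦_⟧ ∘ χ)

class₂≡y : ∀ n (χ : Fin n → Bool) → class₂ n χ ≡ Colouring.y χ
class₂≡y n χ = sumFin≡sum n (⟦_⟧ ∘ opposite ∘ χ)

square : ∀ a → a ^ 2 ≡ a * a
square a = cong (a *_) (*-identityʳ a)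

corollary3p4 : (n : ℕ) (S : Triples n) → IsOA n S → (χ : Fin n → Bool) →
    (numMono n S χ + class₁ n χ * class₂ n χ ≡ class₁ n χ ^ 2 + class₂ n χ ^ 2)
    × (n ^ 2 ≤ 4 * numMono n S χ)
corollary3p4 n S oa χ
  rewrite numMono≡∑³ n S χ | class₁≡x n χ | class₂≡y n χ | square n
        | square (Colouring.x χ) | square (Colouring.y χ)
  = mono-identity , mono-bound
  where open DoubleCount oa χ
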